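{- Given an instance of multi-depot $k$-MLP with point-to-point requests on metric $(V,c)$, construct the point-request instance on node set $V'$ consisting of one node $v_j$ for each request $R_j=(s_j,d_j)$ and one node for each depot $r_i$ (treated as a request with $s=d=r_i$), with distances $c'_{v_iv_j}=c_{s_is_j}+c_{s_id_i}+c_{s_jd_j}$, and with vehicle $i$ located at the node of depot $r_i$. Let $\mathit{OPT}$ be the optimal total latency of the original point-to-point instance and $\mathit{OPT}'$ the optimal total latency of the constructed multi-depot $k$-MLP instance with point requests under $c'$. Then $\mathit{OPT}\le\mathit{OPT}'\le 3\,\mathit{OPT}$. Hence, an $\alpha$-approximate solution to the point-request instance yields (by visiting the requests in the same orders) an $3\alpha$-approximate solution to the point-to-point request instance.
   Context: Multi-depot $k$-MLP with point-to-point requests: $(V,c)$ is a finite metric space; there are $n$ requests $R_j=(s_j,d_j)$ and $k$ vehicles, vehicle $i$ at depot $r_i$. A solution is $k$ paths starting at the respective depots such that each request is served by one vehicle going to $s_j$ and then directly to $d_j$; the latency of a request is the length along its vehicle's path from the depot to $d_j$; the objective is the total latency. Multi-depot $k$-MLP with point requests is the special case where each request is a single node ($s_j=d_j$), the latency being the length along the path from the depot to that node. $(V',c')$ as defined is a metric. An $\alpha$-approximate solution has total latency at most $\alpha$ times the optimum.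
   Formalization: The distances c of the metric and the approximation factor α are rational rather than real. -}

module Defs where

open import Data.Nat using (ℕ)
open import Data.Fin using (Fin; zero; suc)
import Data.Fin as Fin
open import Data.Sum using (_⊎_; inj₁; inj₂)
open import Data.Sum.Properties using (≡-dec)
open import Data.Product using (Σ; _×_; _,_)
open import Data.List using (List; []; _∷_; concatMap; allFin; map)
open import Data.List.Relation.Binary.Permutation.Propositional using (_↭_)
open import Data.Integer using (+_)
open import Data.Rational using (ℚ; 0ℚ; _+_; _*_; _≤_; _/_)
open import Relation.Binary.PropositionalEquality using (_≡_)
open import Relation.Nullary using (yes; no)

3ℚ : ℚ
3ℚ = + 3 / 1

Σℚ : ∀ {k} → (Fin k → ℚ) → ℚ
Σℚ {ℕ.zero}  f = 0ℚ
Σℚ {ℕ.suc k} f = f zero + Σℚ (λ i → f (suc i))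

record IsMetric {m : ℕ} (c : Fin m → Fin m → ℚ) : Set where
  field
    nonneg   : ∀ x y → 0ℚ ≤ c x y
    zero-iff : ∀ x y → c x y ≡ 0ℚ → x ≡ y
    refl0    : ∀ x → c x x ≡ 0ℚ
    sym      : ∀ x y → c x y ≡ c y x
    triangle : ∀ x y z → c x z ≤ c x y + c y z

-- A solution (for k vehicles and n requests) is given by the order in which
-- each vehicle serves its requests; every request is served exactly once.
Routes : ℕ → ℕ → Set
Routes n k = Fin k → List (Fin n)

Valid : ∀ {n k} → Routes n k → Set
Valid {n} {k} ρ = concatMap ρ (allFin k) ↭ allFin n

-- Point-to-point requests on (Fin m, c), requests R_j = (s j, d j),
-- vehicle i at depot r i.
-- latP2P t pos js : sum of latencies of the requests js, served in this
-- order, by a vehicle currently at pos at time t (going pos → s_j → d_j).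
latP2P : ∀ {m n} → (Fin m → Fin m → ℚ) → (Fin n → Fin m) → (Fin n → Fin m) →
         ℚ → Fin m → List (Fin n) → ℚ
latP2P c s d t pos []       = 0ℚ
latP2P c s d t pos (j ∷ js) =
  let t′ = t + c pos (s j) + c (s j) (d j) in t′ + latP2P c s d t′ (d j) js

p2pCost : ∀ {m n k} → (Fin m → Fin m → ℚ) → (Fin n → Fin m) → (Fin n → Fin m) →
          (Fin k → Fin m) → Routes n k → ℚ
p2pCost c s d r ρ = Σℚ (λ i → latP2P c s d 0ℚ (r i) (ρ i))

-- Point requests on a node set N with distance δ: requests are the nodes
-- req j, vehicle i at node dep i.
latPt : ∀ {N : Set} {n} → (N → N → ℚ) → (Fin n → N) → ℚ → N → List (Fin n) → ℚ
latPt δ req t pos []       = 0ℚ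
latPt δ req t pos (j ∷ js) =
  let t′ = t + δ pos (req j) in t′ + latPt δ req t′ (req j) js

pointCost : ∀ {N : Set} {n k} → (N → N → ℚ) → (Fin k → N) → (Fin n → N) →
            Routes n k → ℚ
pointCost δ dep req ρ = Σℚ (λ i → latPt δ req 0ℚ (dep i) (ρ i))

-- The constructed instance: V′ = Fin k ⊎ Fin n (one node per depot, one per
-- request); node a is treated as a request (S a, D a).
V′ : ℕ → ℕ → Set
V′ n k = Fin k ⊎ Fin n

S′ : ∀ {m n k} → (Fin n → Fin m) → (Fin k → Fin m) → V′ n k → Fin m
S′ s r (inj₁ i) = r i
S′ s r (inj₂ j) = s j

D′ : ∀ {m n k} → (Fin n → Fin m) → (Fin k → Fin m) → V′ n k → Fin m
D′ d r (inj₁ i) = r i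
D′ d r (inj₂ j) = d j

c′ : ∀ {m n k} → (Fin m → Fin m → ℚ) → (Fin n → Fin m) → (Fin n → Fin m) →
     (Fin k → Fin m) → V′ n k → V′ n k → ℚ
c′ c s d r a b with ≡-dec Fin._≟_ Fin._≟_ a b
... | yes _ = 0ℚ
... | no  _ = c (S′ s r a) (S′ s r b) + c (S′ s r a) (D′ d r a) + c (S′ s r b) (D′ d r b)

record IsOpt {n k} (cost : Routes n k → ℚ) (x : ℚ) : Set where
  field
    attained : Σ (Routes n k) (λ ρ → Valid ρ × cost ρ ≡ x)
    lower    : ∀ ρ → Valid ρ → x ≤ cost ρ

{-# OPTIONS --safe #-}
-- Serving request j right after node a costs c(D a, s_j) + c(s_j, d_j) in the original instance,
-- and by the triangle inequality this is at most c′(a, j) as long as a ≠ j; consecutive stops of a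
-- valid route are distinct, so every latency can only grow under c′, whence OPT ≤ OPT′.
-- Conversely c′(a, j) ≤ c(D a, s_j) + c(s_j, d_j) + 2 c(S a, D a), and the extra 2 c(S a, D a) is
-- covered by the leg of the previous request, which 3·(latency) counts three times: the arrival
-- times t′ under c′ and t under c satisfy t′ + 2 c(S a, D a) ≤ 3 t along every route.
-- Both bounds hold route by route, so they pass to the optima and to approximate solutions.
module Submission where

open import Defs
open import Data.Nat using (ℕ)
open import Data.Fin using (Fin; zero; suc; _≟_)
open import Data.Sum using (inj₁; inj₂)
open import Data.Sum.Properties using (≡-dec; inj₂-injective)
open import Data.Product using (_×_; _,_)
open import Data.List using (_∷_; []; _++_; concat; map; allFin)
open import Data.List.Membership.Propositional.Properties using (∈-allFin)
open import Data.List.Relation.Unary.All as All using (All; []; _∷_)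
import Data.List.Relation.Unary.All.Properties as All
open import Data.List.Relation.Unary.AllPairs using (AllPairs; []; _∷_)
open import Data.List.Relation.Unary.Unique.Propositional using (Unique)
import Data.List.Relation.Unary.Unique.Propositional.Properties as Unique
open import Data.List.Relation.Binary.Permutation.Propositional using (↭-sym; ↭⇒↭ₛ)
open import Data.List.Relation.Binary.Permutation.Setoid.Properties using (Unique-resp-↭)
open import Data.Rational using (ℚ; 0ℚ; _+_; _*_; _≤_; nonNegative; nonPositive)
open import Data.Rational.Properties
  using (≤-refl; ≤-trans; ≤-reflexive; ≤-antisym; ≤-total; +-mono-≤; +-monoˡ-≤; +-monoʳ-≤;
         +-identityʳ; +-assoc; +-comm; *-zeroʳ; *-assoc; *-comm; *-distribˡ-+;
         *-monoˡ-≤-nonNeg; *-monoˡ-≤-nonPos; module ≤-Reasoning)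
open import Data.Rational.Solver using (module +-*-Solver)
open import Relation.Binary.PropositionalEquality
  using (_≡_; _≢_; refl; cong; sym; trans; setoid)
open import Relation.Nullary using (yes; no; contradiction)
open +-*-Solver using (solve; _:+_; _:*_; _:=_; con)

Σℚ-mono-≤ : ∀ {k} {f g : Fin k → ℚ} → (∀ i → f i ≤ g i) → Σℚ f ≤ Σℚ g
Σℚ-mono-≤ {ℕ.zero}  f≤g = ≤-refl
Σℚ-mono-≤ {ℕ.suc k} f≤g = +-mono-≤ (f≤g zero) (Σℚ-mono-≤ (λ i → f≤g (suc i)))

Σℚ-nonNeg : ∀ {k} {f : Fin k → ℚ} → (∀ i → 0ℚ ≤ f i) → 0ℚ ≤ Σℚ f
Σℚ-nonNeg {ℕ.zero}  0≤f = ≤-refl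
Σℚ-nonNeg {ℕ.suc k} 0≤f = +-mono-≤ (0≤f zero) (Σℚ-nonNeg (λ i → 0≤f (suc i)))

*-distribˡ-Σℚ : ∀ {k} a (f : Fin k → ℚ) → a * Σℚ f ≡ Σℚ (λ i → a * f i)
*-distribˡ-Σℚ {ℕ.zero}  a f = *-zeroʳ a
*-distribˡ-Σℚ {ℕ.suc k} a f =
  trans (*-distribˡ-+ a (f zero) _) (cong (a * f zero +_) (*-distribˡ-Σℚ a (λ i → f (suc i))))

p≤p+q : ∀ {p q} → 0ℚ ≤ q → p ≤ p + q
p≤p+q {p} {q} 0≤q = begin
  p        ≡⟨ sym (+-identityʳ p) ⟩
  p + 0ℚ   ≤⟨ +-monoʳ-≤ p 0≤q ⟩
  p + q    ∎
  where open ≤-Reasoning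

p≤3*p : ∀ {p} → 0ℚ ≤ p → p ≤ 3ℚ * p
p≤3*p {p} 0≤p = begin
  p              ≤⟨ p≤p+q (+-mono-≤ 0≤p 0≤p) ⟩
  p + (p + p)    ≡⟨ solve 1 (λ p → p :+ (p :+ p) := con 3ℚ :* p) refl p ⟩
  3ℚ * p         ∎
  where open ≤-Reasoning

detour-invariant-step : ∀ {t t′ e w x y} → 0ℚ ≤ x → t′ + (w + w) ≤ 3ℚ * t →
                        e ≤ (w + x) + w + y → t′ + e + (y + y) ≤ 3ℚ * (t + x + y)
detour-invariant-step {t} {t′} {e} {w} {x} {y} 0≤x inv e≤ = begin
  t′ + e + (y + y)                   ≤⟨ +-monoˡ-≤ (y + y) (+-monoʳ-≤ t′ e≤) ⟩
  t′ + ((w + x) + w + y) + (y + y)   ≡⟨ solve 4 (λ t′ w x y →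
                                         t′ :+ ((w :+ x) :+ w :+ y) :+ (y :+ y)
                                         := (t′ :+ (w :+ w)) :+ (x :+ con 3ℚ :* y)) refl t′ w x y ⟩
  (t′ + (w + w)) + (x + 3ℚ * y)      ≤⟨ +-mono-≤ inv (+-monoˡ-≤ (3ℚ * y) (p≤3*p 0≤x)) ⟩
  3ℚ * t + (3ℚ * x + 3ℚ * y)         ≡⟨ solve 3 (λ t x y →
                                         con 3ℚ :* t :+ (con 3ℚ :* x :+ con 3ℚ :* y)
                                         := con 3ℚ :* (t :+ x :+ y)) refl t x y ⟩
  3ℚ * (t + x + y)                   ∎
  where open ≤-Reasoning

≤-scaled-optimum : ∀ α β {opt opt′ p} → 0ℚ ≤ opt → opt ≤ opt′ → opt′ ≤ β * opt →
                   opt ≤ p → p ≤ α * opt′ → p ≤ (β * α) * opt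
≤-scaled-optimum α β {opt} {opt′} {p} 0≤opt opt≤opt′ opt′≤βopt opt≤p p≤αopt′
  with ≤-total 0ℚ α
... | inj₁ 0≤α = begin
  p                ≤⟨ p≤αopt′ ⟩
  α * opt′         ≤⟨ *-monoˡ-≤-nonNeg α {{nonNegative 0≤α}} opt′≤βopt ⟩
  α * (β * opt)    ≡⟨ sym (*-assoc α β opt) ⟩
  (α * β) * opt    ≡⟨ cong (_* opt) (*-comm α β) ⟩
  (β * α) * opt    ∎
  where open ≤-Reasoning
... | inj₂ α≤0 = begin
  p                ≤⟨ p≤0 ⟩
  0ℚ               ≡⟨ sym (*-zeroʳ (β * α)) ⟩
  (β * α) * 0ℚ     ≡⟨ cong ((β * α) *_) (sym opt≡0) ⟩
  (β * α) * opt    ∎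
  where
  open ≤-Reasoning
  p≤0 : p ≤ 0ℚ
  p≤0 = begin
    p          ≤⟨ p≤αopt′ ⟩
    α * opt′   ≤⟨ *-monoˡ-≤-nonPos α {{nonPositive α≤0}} (≤-trans 0≤opt opt≤opt′) ⟩
    α * 0ℚ     ≡⟨ *-zeroʳ α ⟩
    0ℚ         ∎
  opt≡0 : opt ≡ 0ℚ
  opt≡0 = ≤-antisym (≤-trans opt≤p p≤0) 0≤opt

module _ {a r} {A : Set a} {R : A → A → Set r} where

  AllPairs-++⁻ˡ : ∀ xs {ys} → AllPairs R (xs ++ ys) → AllPairs R xs
  AllPairs-++⁻ˡ []       _          = []
  AllPairs-++⁻ˡ (x ∷ xs) (px ∷ pxs) = All.++⁻ˡ xs px ∷ AllPairs-++⁻ˡ xs pxs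

  AllPairs-++⁻ʳ : ∀ xs {ys} → AllPairs R (xs ++ ys) → AllPairs R ys
  AllPairs-++⁻ʳ []       pys        = pys
  AllPairs-++⁻ʳ (x ∷ xs) (_ ∷ pxys) = AllPairs-++⁻ʳ xs pxys

  AllPairs-concat⁻ : ∀ xss → AllPairs R (concat xss) → All (AllPairs R) xss
  AllPairs-concat⁻ []         _    = []
  AllPairs-concat⁻ (xs ∷ xss) pxss =
    AllPairs-++⁻ˡ xs pxss ∷ AllPairs-concat⁻ xss (AllPairs-++⁻ʳ xs pxss)

Valid⇒Unique : ∀ {n k} {ρ : Routes n k} → Valid ρ → ∀ i → Unique (ρ i)
Valid⇒Unique {n} {k} {ρ} valid i =
  All.lookup (All.map⁻ (AllPairs-concat⁻ (map ρ (allFin k)) unique-concat)) (∈-allFin i)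
  where
  unique-concat : Unique (concat (map ρ (allFin k)))
  unique-concat = Unique-resp-↭ (setoid (Fin n)) (↭⇒↭ₛ (↭-sym valid)) (Unique.allFin⁺ n)

module Reduction {m n k} (c : Fin m → Fin m → ℚ) (metric : IsMetric c)
         (s d : Fin n → Fin m) (r : Fin k → Fin m) where

  open IsMetric metric using (nonneg; refl0; triangle) renaming (sym to c-sym)

  private
    δ : V′ n k → V′ n k → ℚ
    δ = c′ c s d r

    S D : V′ n k → Fin m
    S = S′ s r
    D = D′ d r

  c′-off-diagonal : ∀ {a b} → a ≢ b → δ a b ≡ c (S a) (S b) + c (S a) (D a) + c (S b) (D b)
  c′-off-diagonal {a} {b} a≢b with ≡-dec _≟_ _≟_ a b
  ... | yes a≡b = contradiction a≡b a≢b
  ... | no  _   = refl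

  c′-≤ : ∀ a b → δ a b ≤ c (S a) (S b) + c (S a) (D a) + c (S b) (D b)
  c′-≤ a b with ≡-dec _≟_ _≟_ a b
  ... | yes _ = +-mono-≤ (+-mono-≤ (nonneg _ _) (nonneg _ _)) (nonneg _ _)
  ... | no  _ = ≤-refl

  detour-≤-c′ : ∀ {a b} → a ≢ b → c (D a) (S b) + c (S b) (D b) ≤ δ a b
  detour-≤-c′ {a} {b} a≢b = begin
    c (D a) (S b) + c (S b) (D b)                     ≤⟨ +-monoˡ-≤ _ (triangle (D a) (S a) (S b)) ⟩
    c (D a) (S a) + c (S a) (S b) + c (S b) (D b)     ≡⟨ cong (_+ c (S b) (D b)) (trans
                                                           (cong (_+ c (S a) (S b)) (c-sym (D a) (S a)))
                                                           (+-comm (c (S a) (D a)) (c (S a) (S b)))) ⟩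
    c (S a) (S b) + c (S a) (D a) + c (S b) (D b)     ≡⟨ sym (c′-off-diagonal a≢b) ⟩
    δ a b                                             ∎
    where open ≤-Reasoning

  -- c′ vanishes on the diagonal, so the comparison needs consecutive stops to be distinct.
  latP2P-≤-latPt : ∀ a js {t t′} → Unique (a ∷ map inj₂ js) → t ≤ t′ →
                   latP2P c s d t (D a) js ≤ latPt δ inj₂ t′ a js
  latP2P-≤-latPt a []       _                     _    = ≤-refl
  latP2P-≤-latPt a (j ∷ js) {t} {t′} ((a≢j ∷ _) ∷ unique) t≤t′ =
    +-mono-≤ arrival≤ (latP2P-≤-latPt (inj₂ j) js unique arrival≤)
    where
    arrival≤ : t + c (D a) (s j) + c (s j) (d j) ≤ t′ + δ a (inj₂ j)
    arrival≤ = ≤-trans (≤-reflexive (+-assoc t _ _)) (+-mono-≤ t≤t′ (detour-≤-c′ a≢j))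

  -- t′ and t are the current times under c′ and under c; the slack 2 c(S a, D a) pays for the
  -- back-and-forth S a → D a that the next c′ edge charges again.
  latPt-≤-3*latP2P : ∀ a js {t t′} → t′ + (c (S a) (D a) + c (S a) (D a)) ≤ 3ℚ * t →
                     latPt δ inj₂ t′ a js ≤ 3ℚ * latP2P c s d t (D a) js
  latPt-≤-3*latP2P a []       inv = ≤-refl
  latPt-≤-3*latP2P a (j ∷ js) {t} {t′} inv = begin
    t′ + δ a (inj₂ j) + latPt δ inj₂ _ (inj₂ j) js   ≤⟨ +-mono-≤ arrival≤ (latPt-≤-3*latP2P (inj₂ j) js inv′) ⟩
    3ℚ * u + 3ℚ * latP2P c s d u (d j) js           ≡⟨ sym (*-distribˡ-+ 3ℚ u _) ⟩
    3ℚ * (u + latP2P c s d u (d j) js)              ∎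
    where
    open ≤-Reasoning
    x y u : ℚ
    x = c (D a) (s j)
    y = c (s j) (d j)
    u = t + x + y
    δ≤ : δ a (inj₂ j) ≤ (c (S a) (D a) + x) + c (S a) (D a) + y
    δ≤ = ≤-trans (c′-≤ a (inj₂ j)) (+-monoˡ-≤ y (+-monoˡ-≤ _ (triangle (S a) (D a) (s j))))
    inv′ : t′ + δ a (inj₂ j) + (y + y) ≤ 3ℚ * u
    inv′ = detour-invariant-step {t} {t′} {w = c (S a) (D a)} {y = y} (nonneg (D a) (s j)) inv δ≤
    arrival≤ : t′ + δ a (inj₂ j) ≤ 3ℚ * u
    arrival≤ = ≤-trans (p≤p+q (+-mono-≤ (nonneg (s j) (d j)) (nonneg (s j) (d j)))) inv′

  latP2P-nonNeg : ∀ pos js {t} → 0ℚ ≤ t → 0ℚ ≤ latP2P c s d t pos js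
  latP2P-nonNeg pos []       0≤t = ≤-refl
  latP2P-nonNeg pos (j ∷ js) {t} 0≤t = +-mono-≤ 0≤arrival (latP2P-nonNeg (d j) js 0≤arrival)
    where
    0≤arrival : 0ℚ ≤ t + c pos (s j) + c (s j) (d j)
    0≤arrival = +-mono-≤ (+-mono-≤ 0≤t (nonneg pos (s j))) (nonneg (s j) (d j))

  p2pCost-≤-pointCost : ∀ ρ → Valid ρ → p2pCost c s d r ρ ≤ pointCost δ inj₁ inj₂ ρ
  p2pCost-≤-pointCost ρ valid = Σℚ-mono-≤ λ i →
    latP2P-≤-latPt (inj₁ i) (ρ i) (depot-fresh i ∷ Unique.map⁺ inj₂-injective (Valid⇒Unique valid i)) ≤-refl
    where
    depot-fresh : ∀ i → All (inj₁ i ≢_) (map inj₂ (ρ i))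
    depot-fresh i = All.map⁺ (All.universal (λ _ ()) (ρ i))

  pointCost-≤-3*p2pCost : ∀ ρ → pointCost δ inj₁ inj₂ ρ ≤ 3ℚ * p2pCost c s d r ρ
  pointCost-≤-3*p2pCost ρ = begin
    pointCost δ inj₁ inj₂ ρ       ≤⟨ Σℚ-mono-≤ (λ i → latPt-≤-3*latP2P (inj₁ i) (ρ i) (depot-invariant i)) ⟩
    Σℚ (λ i → 3ℚ * latency i)     ≡⟨ sym (*-distribˡ-Σℚ 3ℚ latency) ⟩
    3ℚ * p2pCost c s d r ρ        ∎
    where
    open ≤-Reasoning
    latency : Fin k → ℚ
    latency i = latP2P c s d 0ℚ (r i) (ρ i)
    depot-invariant : ∀ i → 0ℚ + (c (r i) (r i) + c (r i) (r i)) ≤ 3ℚ * 0ℚ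
    depot-invariant i rewrite refl0 (r i) = ≤-refl

  p2pCost-nonNeg : ∀ ρ → 0ℚ ≤ p2pCost c s d r ρ
  p2pCost-nonNeg ρ = Σℚ-nonNeg λ i → latP2P-nonNeg (r i) (ρ i) ≤-refl

lemma4p6 : ∀ {m n k} (c : Fin m → Fin m → ℚ) → IsMetric c →
    (s d : Fin n → Fin m) (r : Fin k → Fin m) (OPT OPT′ : ℚ) →
    IsOpt (p2pCost c s d r) OPT →
    IsOpt (pointCost (c′ c s d r) inj₁ inj₂) OPT′ →
    (OPT ≤ OPT′ × OPT′ ≤ 3ℚ * OPT) ×
    (∀ (α : ℚ) (ρ : Routes n k) → Valid ρ →
       pointCost (c′ c s d r) inj₁ inj₂ ρ ≤ α * OPT′ →
       p2pCost c s d r ρ ≤ (3ℚ * α) * OPT)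
lemma4p6 c metric s d r OPT OPT′ opt opt′
  with IsOpt.attained opt | IsOpt.attained opt′
... | ρ , valid , cost≡OPT | ρ′ , valid′ , cost≡OPT′ =
  (OPT≤OPT′ , OPT′≤3*OPT) , λ α σ σ-valid σ-approx →
    ≤-scaled-optimum α 3ℚ 0≤OPT OPT≤OPT′ OPT′≤3*OPT (IsOpt.lower opt σ σ-valid)
      (≤-trans (p2pCost-≤-pointCost σ σ-valid) σ-approx)
  where
  open Reduction c metric s d r
  open ≤-Reasoning

  0≤OPT : 0ℚ ≤ OPT
  0≤OPT = ≤-trans (p2pCost-nonNeg ρ) (≤-reflexive cost≡OPT)

  OPT≤OPT′ : OPT ≤ OPT′
  OPT≤OPT′ = begin
    OPT                                      ≤⟨ IsOpt.lower opt ρ′ valid′ ⟩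
    p2pCost c s d r ρ′                       ≤⟨ p2pCost-≤-pointCost ρ′ valid′ ⟩
    pointCost (c′ c s d r) inj₁ inj₂ ρ′      ≡⟨ cost≡OPT′ ⟩
    OPT′                                     ∎

  OPT′≤3*OPT : OPT′ ≤ 3ℚ * OPT
  OPT′≤3*OPT = begin
    OPT′                                     ≤⟨ IsOpt.lower opt′ ρ valid ⟩
    pointCost (c′ c s d r) inj₁ inj₂ ρ       ≤⟨ pointCost-≤-3*p2pCost ρ ⟩
    3ℚ * p2pCost c s d r ρ                   ≡⟨ cong (3ℚ *_) cost≡OPT ⟩
    3ℚ * OPT                                 ∎
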